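{- Let $a_{n,k}$ be the number of LCO forests of size $n$ having exactly $k$ vertices with no children (counting isolated roots). Then \[ \sum_{n,k\ge 0} a_{n,k}\,x^{n}y^{k}=\frac{1-\sqrt{1-4x\,\frac{1-x}{1-xy}}}{2x}. \]
   Context: An LCO forest is a finite (possibly empty) list of ordered (plane) rooted trees, where a tree may consist of a root only, such that: no vertex has exactly one child; each vertex is labeled with an integer composition whose last entry is $1$; each vertex that has at least one child and whose label composition has size (sum of entries) at least $2$ is additionally colored either $top$ or $bot$; and every vertex that has a parent but no children and is the rightmost child of its parent has a label composition of size at least $2$. The size of an LCO forest is the sum of the sizes of its label compositions. (Equivalently, joining all roots of the forest to a new root gives an LCO tree whose leaves are exactly the childless vertices of the forest.) -}

module Defs where

open import Data.Bool using (Bool; true; false; _∧_; not; if_then_else_)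
open import Data.Maybe using (Maybe; just; nothing; is-just; is-nothing)
open import Data.Nat using (ℕ; zero; suc; _≡ᵇ_; _≤ᵇ_; _∸_)
open import Data.List using (List; []; _∷_; upTo; foldr; map)
open import Data.Nat.ListAction using (sum)
open import Data.Integer as ℤ using (ℤ; +_)
open import Data.Product using (Σ; _×_)
open import Data.Bool using (T)
open import Relation.Binary.PropositionalEquality using (_≡_)

-- Compositions whose last entry is 1 (labels of LCO vertices)

lastIs1 : List ℕ → Bool
lastIs1 []           = false
lastIs1 (x ∷ [])     = x ≡ᵇ 1
lastIs1 (_ ∷ y ∷ r)  = lastIs1 (y ∷ r)

allPos : List ℕ → Bool
allPos []      = true
allPos (e ∷ r) = (1 ≤ᵇ e) ∧ allPos r

isLabel : List ℕ → Bool
isLabel c = allPos c ∧ lastIs1 c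

data Color : Set where
  top bot : Color

-- node (label composition) (optional color) (ordered list of children)
data RTree : Set where
  node : List ℕ → Maybe Color → List RTree → RTree

colorOK : List RTree → ℕ → Maybe Color → Bool
colorOK []      s m = is-nothing m
colorOK (_ ∷ _) s m = if 2 ≤ᵇ s then is-just m else is-nothing m

notOneChild : List RTree → Bool
notOneChild (_ ∷ []) = false
notOneChild _        = true

leafOK : RTree → Bool
leafOK (node c _ [])      = 2 ≤ᵇ sum c
leafOK (node _ _ (_ ∷ _)) = true

rightmostOK : List RTree → Bool
rightmostOK []          = true
rightmostOK (t ∷ [])    = leafOK t
rightmostOK (_ ∷ u ∷ r) = rightmostOK (u ∷ r)

mutual
  validTree : RTree → Bool
  validTree (node c m ts) =
    isLabel c ∧ colorOK ts (sum c) m ∧ notOneChild ts ∧ rightmostOK ts ∧ validForest ts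

  -- every tree in the list is valid (no rightmost condition on the list itself:
  -- forest roots have no parent)
  validForest : List RTree → Bool
  validForest []       = true
  validForest (t ∷ ts) = validTree t ∧ validForest ts

mutual
  sizeT : RTree → ℕ
  sizeT (node c _ ts) = sum c Data.Nat.+ sizeF ts

  sizeF : List RTree → ℕ
  sizeF []       = 0
  sizeF (t ∷ ts) = sizeT t Data.Nat.+ sizeF ts

mutual
  leavesT : RTree → ℕ
  leavesT (node _ _ [])          = 1
  leavesT (node _ _ ts@(_ ∷ _))  = leavesF ts

  leavesF : List RTree → ℕ
  leavesF []       = 0
  leavesF (t ∷ ts) = leavesT t Data.Nat.+ leavesF ts

LCO : ℕ → ℕ → Set
LCO n k = Σ (List RTree) (λ f → T (validForest f) × sizeF f ≡ n × leavesF f ≡ k)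

-- Formal power series in x, y with integer coefficients:
-- F n k is the coefficient of x^n y^k.

PS : Set
PS = ℕ → ℕ → ℤ

sumℤ : List ℤ → ℤ
sumℤ = foldr ℤ._+_ (+ 0)

_⊕_ : PS → PS → PS
(F ⊕ G) n k = F n k ℤ.+ G n k

_⊖_ : PS → PS → PS
(F ⊖ G) n k = F n k ℤ.- G n k

_⊛_ : PS → PS → PS
(F ⊛ G) n k = sumℤ (map (λ i → sumℤ (map (λ j → F i j ℤ.* G (n ∸ i) (k ∸ j)) (upTo (suc k)))) (upTo (suc n)))

_·_ : ℤ → PS → PS
(c · F) n k = c ℤ.* F n k

oneS : PS
oneS zero zero = + 1
oneS _    _    = + 0

xS : PS
xS (suc zero) zero = + 1
xS _          _    = + 0

-- 1/(1 - x y) = Σ_m x^m y^m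
geomXY : PS
geomXY n k = if n ≡ᵇ k then + 1 else + 0

_≈_ : PS → PS → Set
F ≈ G = ∀ n k → F n k ≡ G n k

radicand : PS
radicand = oneS ⊖ ((+ 4) · (xS ⊛ ((oneS ⊖ xS) ⊛ geomXY)))

module Submission where

-- Decomposing an LCO forest into a sequence of trees, a tree into a leaf or an internal vertex with its
-- list of at least two children, and a label into its first entry and the rest gives size- and
-- leaf-preserving bijections between graded classes. Counting both sides turns them into polynomial
-- equations between generating functions in ℤ[[x,y]] = ℤ[[y]][[x]]; no count other than that of the
-- forests is ever computed, since every class is a subclass of forests or trees, or isomorphic to sums
-- and products of counted classes. Eliminating all unknowns but the forest series F leaves
-- (F - x F²) (1 - x y) = 1 - x, so S = 1 - 2 x F satisfies S² = 1 - 4 x (F - x F²) = 1 - 4 x (1 - x) / (1 - x y).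

open import Algebra.Bundles using (CommutativeMonoid; CommutativeRing; RawRing)
open import Algebra.Structures using (IsCommutativeRing)
open import Algebra.Solver.Ring.AlmostCommutativeRing
  using (_-Raw-AlmostCommutative⟶_; fromCommutativeRing; -raw-almostCommutative⟶)
open import Data.Bool using (Bool; true; false; T; _∧_; if_then_else_)
open import Data.Bool.Properties using (T-∧; T-irrelevant)
open import Data.Empty using (⊥; ⊥-elim)
open import Data.Fin as Fin using (Fin; toℕ; fromℕ<)
import Data.Fin.Properties as Fin
open import Data.Fin.Permutation using (↔⇒≡)
open import Data.Integer as ℤ using (ℤ; +_)
import Data.Integer.Properties as ℤ
open import Data.Integer.Tactic.RingSolver using (solve-∀)
open import Data.List using (List; []; _∷_; map; upTo; applyUpTo)
open import Data.Maybe using (Maybe; just; nothing; is-just; is-nothing)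
open import Data.Nat as ℕ using (ℕ; zero; suc; _∸_; _≤_; _<_; s≤s; z≤n; _≡ᵇ_; _≤ᵇ_)
import Data.Nat.Properties as ℕ
open import Data.Nat.ListAction using (sum)
open import Data.Product using (Σ; _×_; _,_; proj₁; proj₂)
open import Data.Product.Function.Dependent.Propositional using (Σ-↔)
open import Data.Product.Function.NonDependent.Propositional using (_×-↔_)
open import Data.Sum using (_⊎_; inj₁; inj₂)
open import Data.Sum.Function.Propositional using (_⊎-↔_)
open import Data.Unit using (⊤; tt)
open import Data.Vec.Functional using (Vector)
open import Function using (_∘_)
open import Function.Bundles using (_↔_; mk↔ₛ′; Inverse; Equivalence)
open import Function.Properties.Inverse using (↔-sym; ↔-trans; ↔-refl)
open import Relation.Binary.PropositionalEquality as ≡ using (_≡_)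
open import Relation.Nullary using (yes; no)

-- Finite sums and power series over a commutative ring

module Sums {c ℓ} (M : CommutativeMonoid c ℓ) where

  open CommutativeMonoid M
    renaming ( _∙_ to _+_ ; ε to 0# ; ∙-cong to +-cong ; ∙-congˡ to +-congˡ ; ∙-congʳ to +-congʳ
             ; assoc to +-assoc ; comm to +-comm ; identityʳ to +-identityʳ )
  open import Algebra.Properties.CommutativeMonoid.Sum M
  open import Relation.Binary.Reasoning.Setoid setoid

  ∑≤ : ℕ → (ℕ → Carrier) → Carrier
  ∑≤ n f = ∑[ i ≤ n ] f (toℕ i)

  ∑≤-cong : ∀ n {f g : ℕ → Carrier} → (∀ i → i ≤ n → f i ≈ g i) → ∑≤ n f ≈ ∑≤ n g
  ∑≤-cong n f≈g = sum-cong-≋ {suc n} (λ i → f≈g (toℕ i) (Fin.toℕ≤pred[n] i))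

  ∑≤-cong′ : ∀ n {f g : ℕ → Carrier} → (∀ i → f i ≈ g i) → ∑≤ n f ≈ ∑≤ n g
  ∑≤-cong′ n f≈g = ∑≤-cong n (λ i _ → f≈g i)

  ∑≤-distrib-+ : ∀ n (f g : ℕ → Carrier) → ∑≤ n (λ i → f i + g i) ≈ ∑≤ n f + ∑≤ n g
  ∑≤-distrib-+ n f g = ∑-distrib-+ {suc n} (f ∘ toℕ) (g ∘ toℕ)

  ∑≤-head : ∀ n (f : ℕ → Carrier) → (∀ i → f (suc i) ≈ 0#) → ∑≤ n f ≈ f 0
  ∑≤-head n f tail≈0 =
    trans (+-congˡ (trans (sum-cong-≋ {n} (tail≈0 ∘ toℕ)) (sum-replicate-zero n))) (+-identityʳ (f 0))

  ∑≤-last : ∀ n (f : ℕ → Carrier) → ∑≤ (suc n) f ≈ ∑≤ n f + f (suc n)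
  ∑≤-last n f = begin
    ∑≤ (suc n) f
      ≈⟨ sum-init-last (f ∘ toℕ) ⟩
    ∑[ i ≤ n ] f (toℕ (Fin.inject₁ i)) + f (toℕ (Fin.fromℕ (suc n)))
      ≡⟨ ≡.cong₂ _+_ (sum-cong-≗ {n = suc n} {x = f ∘ toℕ ∘ Fin.inject₁} {y = f ∘ toℕ} (≡.cong f ∘ Fin.toℕ-inject₁))
                     (≡.cong f (Fin.toℕ-fromℕ (suc n))) ⟩
    ∑≤ n f + f (suc n)
      ∎

  ∑≤-reverse : ∀ n (f : ℕ → Carrier) → ∑≤ n f ≈ ∑≤ n (λ i → f (n ∸ i))
  ∑≤-reverse zero    f = refl
  ∑≤-reverse (suc n) f = begin
    f 0 + ∑≤ n (f ∘ suc)
      ≈⟨ +-congˡ (∑≤-reverse n (f ∘ suc)) ⟩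
    f 0 + ∑≤ n (λ i → f (suc (n ∸ i)))
      ≈⟨ +-comm _ _ ⟩
    ∑≤ n (λ i → f (suc (n ∸ i))) + f 0
      ≡⟨ ≡.cong₂ _+_ (sum-cong-≗ {n = suc n} {x = λ i → f (suc (n ∸ toℕ i))} {y = λ i → f (suc n ∸ toℕ i)}
                                 (λ i → ≡.cong f (≡.sym (ℕ.+-∸-assoc 1 (Fin.toℕ≤pred[n] i)))))
                     (≡.cong f (≡.sym (ℕ.n∸n≡0 n))) ⟩
    ∑≤ n (λ i → f (suc n ∸ i)) + f (suc n ∸ suc n)
      ≈⟨ ∑≤-last n (λ i → f (suc n ∸ i)) ⟨
    ∑≤ (suc n) (λ i → f (suc n ∸ i))
      ∎

  ∑≤-triangle : ∀ n (g : ℕ → ℕ → Carrier) →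
                ∑≤ n (λ i → ∑≤ i (λ a → g a i)) ≈ ∑≤ n (λ a → ∑≤ (n ∸ a) (λ c → g a (a ℕ.+ c)))
  ∑≤-triangle zero    g = refl
  ∑≤-triangle (suc n) g = begin
    ∑≤ (suc n) (λ i → ∑≤ i (λ a → g a i))
      ≈⟨ ∑≤-last n (λ i → ∑≤ i (λ a → g a i)) ⟩
    ∑≤ n (λ i → ∑≤ i (λ a → g a i)) + ∑≤ (suc n) (λ a → g a (suc n))
      ≈⟨ +-cong (∑≤-triangle n g) (∑≤-last n (λ a → g a (suc n))) ⟩
    ∑≤ n (λ a → row a (n ∸ a)) + (∑≤ n (λ a → g a (suc n)) + g (suc n) (suc n))
      ≈⟨ +-assoc _ _ _ ⟨
    ∑≤ n (λ a → row a (n ∸ a)) + ∑≤ n (λ a → g a (suc n)) + g (suc n) (suc n)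
      ≈⟨ +-congʳ (∑≤-distrib-+ n (λ a → row a (n ∸ a)) (λ a → g a (suc n))) ⟨
    ∑≤ n (λ a → row a (n ∸ a) + g a (suc n)) + g (suc n) (suc n)
      ≈⟨ +-cong (∑≤-cong n extend-row) last-row ⟩
    ∑≤ n (λ a → row a (suc n ∸ a)) + row (suc n) (suc n ∸ suc n)
      ≈⟨ ∑≤-last n (λ a → row a (suc n ∸ a)) ⟨
    ∑≤ (suc n) (λ a → row a (suc n ∸ a))
      ∎
    where
    row : ℕ → ℕ → Carrier
    row a m = ∑≤ m (λ c → g a (a ℕ.+ c))
    last-row : g (suc n) (suc n) ≈ row (suc n) (suc n ∸ suc n)
    last-row = begin
      g (suc n) (suc n)             ≡⟨ ≡.cong (g (suc n)) (ℕ.+-identityʳ (suc n)) ⟨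
      g (suc n) (suc n ℕ.+ 0)       ≈⟨ +-identityʳ _ ⟨
      row (suc n) 0                 ≡⟨ ≡.cong (row (suc n)) (ℕ.n∸n≡0 n) ⟨
      row (suc n) (suc n ∸ suc n)   ∎
    extend-row : ∀ a → a ≤ n → row a (n ∸ a) + g a (suc n) ≈ row a (suc n ∸ a)
    extend-row a a≤n = begin
      row a (n ∸ a) + g a (suc n)
        ≡⟨ ≡.cong (λ m → row a (n ∸ a) + g a m) (≡.sym (ℕ.m+[n∸m]≡n (ℕ.m≤n⇒m≤1+n a≤n))) ⟩
      row a (n ∸ a) + g a (a ℕ.+ (suc n ∸ a))
        ≡⟨ ≡.cong (λ m → row a (n ∸ a) + g a (a ℕ.+ m)) (ℕ.+-∸-assoc 1 a≤n) ⟩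
      row a (n ∸ a) + g a (a ℕ.+ suc (n ∸ a))
        ≈⟨ ∑≤-last (n ∸ a) (λ c → g a (a ℕ.+ c)) ⟨
      row a (suc (n ∸ a))
        ≡⟨ ≡.cong (row a) (ℕ.+-∸-assoc 1 a≤n) ⟨
      row a (suc n ∸ a)
        ∎

module PowerSeries {c ℓ} (R : CommutativeRing c ℓ) where

  open CommutativeRing R hiding (isCommutativeRing)
  open Sums +-commutativeMonoid
  open import Algebra.Properties.Semiring.Sum semiring using (*-distribˡ-sum; *-distribʳ-sum)
  open import Algebra.Properties.Ring ring using (-0#≈0#)
  import Algebra.Construct.Pointwise ℕ as Pointwise
  open import Relation.Binary.Reasoning.Setoid setoid

  Series : Set c
  Series = ℕ → Carrier

  infix  4 _≈ₛ_
  infixl 6 _+ₛ_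
  infixl 7 _*ₛ_

  _≈ₛ_ : Series → Series → Set ℓ
  f ≈ₛ g = ∀ n → f n ≈ g n

  _+ₛ_ : Series → Series → Series
  (f +ₛ g) n = f n + g n

  -ₛ_ : Series → Series
  (-ₛ f) n = - f n

  0ₛ : Series
  0ₛ _ = 0#

  constant : Carrier → Series
  constant c zero    = c
  constant c (suc _) = 0#

  1ₛ : Series
  1ₛ = constant 1#

  _*ₛ_ : Series → Series → Series
  (f *ₛ g) n = ∑≤ n (λ i → f i * g (n ∸ i))

  *ₛ-cong : ∀ {f f′ g g′} → f ≈ₛ f′ → g ≈ₛ g′ → f *ₛ g ≈ₛ f′ *ₛ g′
  *ₛ-cong f≈f′ g≈g′ n = ∑≤-cong′ n (λ i → *-cong (f≈f′ i) (g≈g′ (n ∸ i)))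

  *ₛ-comm : ∀ f g → f *ₛ g ≈ₛ g *ₛ f
  *ₛ-comm f g n = begin
    ∑≤ n (λ i → f i * g (n ∸ i))
      ≈⟨ ∑≤-reverse n (λ i → f i * g (n ∸ i)) ⟩
    ∑≤ n (λ i → f (n ∸ i) * g (n ∸ (n ∸ i)))
      ≈⟨ ∑≤-cong n (λ i i≤n → trans (*-comm _ _) (reflexive (≡.cong (λ j → g j * f (n ∸ i)) (ℕ.m∸[m∸n]≡n i≤n)))) ⟩
    ∑≤ n (λ i → g i * f (n ∸ i))
      ∎

  constant-*ₛ : ∀ c f → constant c *ₛ f ≈ₛ (λ n → c * f n)
  constant-*ₛ c f n = ∑≤-head n (λ i → constant c i * f (n ∸ i)) (λ i → zeroˡ (f (n ∸ suc i)))

  *ₛ-identityˡ : ∀ f → 1ₛ *ₛ f ≈ₛ f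
  *ₛ-identityˡ f n = trans (constant-*ₛ 1# f n) (*-identityˡ (f n))

  *ₛ-distribʳ : ∀ h f g → (f +ₛ g) *ₛ h ≈ₛ f *ₛ h +ₛ g *ₛ h
  *ₛ-distribʳ h f g n = trans (∑≤-cong′ n (λ i → distribʳ (h (n ∸ i)) (f i) (g i)))
                              (∑≤-distrib-+ n (λ i → f i * h (n ∸ i)) (λ i → g i * h (n ∸ i)))

  *ₛ-distribˡ : ∀ h f g → h *ₛ (f +ₛ g) ≈ₛ h *ₛ f +ₛ h *ₛ g
  *ₛ-distribˡ h f g n =
    trans (*ₛ-comm h (f +ₛ g) n) (trans (*ₛ-distribʳ h f g n) (+-cong (*ₛ-comm f h n) (*ₛ-comm g h n)))

  *ₛ-assoc : ∀ f g h → (f *ₛ g) *ₛ h ≈ₛ f *ₛ (g *ₛ h)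
  *ₛ-assoc f g h n = begin
    ∑≤ n (λ i → ∑≤ i (λ a → f a * g (i ∸ a)) * h (n ∸ i))
      ≈⟨ ∑≤-cong′ n (λ i → *-distribʳ-sum {suc i} (h (n ∸ i)) (λ a → f (toℕ a) * g (i ∸ toℕ a))) ⟩
    ∑≤ n (λ i → ∑≤ i (λ a → f a * g (i ∸ a) * h (n ∸ i)))
      ≈⟨ ∑≤-triangle n (λ a i → f a * g (i ∸ a) * h (n ∸ i)) ⟩
    ∑≤ n (λ a → ∑≤ (n ∸ a) (λ c → f a * g (a ℕ.+ c ∸ a) * h (n ∸ (a ℕ.+ c))))
      ≈⟨ ∑≤-cong′ n (λ a → ∑≤-cong′ (n ∸ a) (λ c → trans
           (reflexive (≡.cong₂ (λ j m → f a * g j * h m) (ℕ.m+n∸m≡n a c) (≡.sym (ℕ.∸-+-assoc n a c))))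
           (*-assoc _ _ _))) ⟩
    ∑≤ n (λ a → ∑≤ (n ∸ a) (λ c → f a * (g c * h (n ∸ a ∸ c))))
      ≈⟨ ∑≤-cong′ n (λ a → *-distribˡ-sum {suc (n ∸ a)} (f a) (λ c → g (toℕ c) * h (n ∸ a ∸ toℕ c))) ⟨
    ∑≤ n (λ a → f a * ∑≤ (n ∸ a) (λ c → g c * h (n ∸ a ∸ c)))
      ∎

  isCommutativeRing : IsCommutativeRing _≈ₛ_ _+ₛ_ _*ₛ_ -ₛ_ 0ₛ 1ₛ
  isCommutativeRing = record
    { isRing = record
      { +-isAbelianGroup = Pointwise.isAbelianGroup +-isAbelianGroup
      ; *-cong           = *ₛ-cong
      ; *-assoc          = *ₛ-assoc
      ; *-identity       = *ₛ-identityˡ , (λ f n → trans (*ₛ-comm f 1ₛ n) (*ₛ-identityˡ f n))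
      ; distrib          = *ₛ-distribˡ , *ₛ-distribʳ
      }
    ; *-comm = *ₛ-comm
    }

  commutativeRing : CommutativeRing c ℓ
  commutativeRing = record { isCommutativeRing = isCommutativeRing }

  constant-pointwise : ∀ {a g} → a ≈ g 0 → (∀ n → 0# ≈ g (suc n)) → constant a ≈ₛ g
  constant-pointwise a≈g₀ _   zero    = a≈g₀
  constant-pointwise _    0≈g (suc n) = 0≈g n

  constant-morphism : ∀ {r₁ r₂} {Coeff : RawRing r₁ r₂} →
                      Coeff -Raw-AlmostCommutative⟶ fromCommutativeRing R →
                      Coeff -Raw-AlmostCommutative⟶ fromCommutativeRing commutativeRing
  constant-morphism ι = record
    { ⟦_⟧    = λ c → constant ⟦ c ⟧
    ; +-homo = λ c d → constant-pointwise (+-homo c d) (λ _ → sym (+-identityʳ 0#))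
    ; *-homo = λ c d n →
        trans (constant-pointwise {g = λ m → ⟦ c ⟧ * constant ⟦ d ⟧ m} (*-homo c d) (λ _ → sym (zeroʳ ⟦ c ⟧)) n)
              (sym (constant-*ₛ ⟦ c ⟧ (constant ⟦ d ⟧) n))
    ; -‿homo = λ c → constant-pointwise (-‿homo c) (λ _ → sym -0#≈0#)
    ; 0-homo = constant-pointwise 0-homo (λ _ → refl)
    ; 1-homo = constant-pointwise 1-homo (λ _ → refl)
    }
    where open _-Raw-AlmostCommutative⟶_ ι

-- The equations of the LCO generating functions

module LCOSystem {c ℓ} (R : CommutativeRing c ℓ)
  (ℤ→R : ℤ.+-*-rawRing -Raw-AlmostCommutative⟶ fromCommutativeRing R) where

  open CommutativeRing R
  open import Algebra.Properties.Ring ring using (x≈y⇒x∙y⁻¹≈ε)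
  open _-Raw-AlmostCommutative⟶_ ℤ→R using () renaming (⟦_⟧ to ι)
  open import Relation.Binary.Reasoning.Setoid setoid

  private
    coefficients≟ : ∀ m n → Maybe (ι m ≈ ι n)
    coefficients≟ m n with m ℤ.≟ n
    ... | yes ≡.refl = just refl
    ... | no _       = nothing

  open import Algebra.Solver.Ring ℤ.+-*-rawRing (fromCommutativeRing R) ℤ→R coefficients≟
    using (Polynomial; solve; _:=_; _:+_; _:*_; _:-_; con)

  -- Numerals are images of integers, so that the ring solver normalises with coefficients in ℤ.
  𝟏 𝟐 𝟒 : Carrier
  𝟏 = ι (+ 1)
  𝟐 = ι (+ 2)
  𝟒 = ι (+ 4)

  1ₚ 2ₚ 4ₚ : ∀ {n} → Polynomial n
  1ₚ = con (+ 1)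
  2ₚ = con (+ 2)
  4ₚ = con (+ 4)

  sub-right : ∀ {a b d} → a ≈ b + d → a - d ≈ b
  sub-right {a} {b} {d} a≈b+d = begin
    a - d      ≈⟨ +-congʳ a≈b+d ⟩
    b + d - d  ≈⟨ solve 2 (λ b d → b :+ d :- d := b) refl b d ⟩
    b          ∎

  sub-left : ∀ {a b d} → a ≈ b + d → a - b ≈ d
  sub-left {a} {b} {d} a≈b+d = sub-right (trans a≈b+d (+-comm b d))

  cancel : ∀ {a b d} → a ≈ b → d + (a - b) ≈ d
  cancel {d = d} a≈b = trans (+-congˡ (x≈y⇒x∙y⁻¹≈ε a≈b)) (+-identityʳ d)

  module _ (x y F T T′ C C₁ L P N K G : Carrier)
    (forests     : F  ≈ 𝟏 + T * F)
    (trees       : T  ≈ y * L + N * C)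
    (children    : C  ≈ T * C₁)
    (children₁   : C₁ ≈ T′ + T * C₁)
    (rightmost   : T  ≈ T′ + x * y)
    (labels      : L  ≈ x + P * L)
    (positives   : P  ≈ x + x * P)
    (decorations : N  ≈ x + K * (P * L))
    (colors      : K  ≈ 𝟏 + 𝟏)
    (diagonal    : G  ≈ 𝟏 + x * y * G)
    where

    positives-closed : P * (𝟏 - x) ≈ x
    positives-closed = begin
      P * (𝟏 - x)
        ≈⟨ solve 2 (λ x p → p :* (1ₚ :- x) := p :- x :* p) refl x P ⟩
      P - x * P
        ≈⟨ sub-right positives ⟩
      x ∎

    labels-closed : L * (𝟏 - 𝟐 * x) ≈ x * (𝟏 - x)
    labels-closed = begin
      L * (𝟏 - 𝟐 * x)
        ≈⟨ solve 2 (λ x l → l :* (1ₚ :- 2ₚ :* x) := l :* (1ₚ :- x) :- x :* l) refl x L ⟩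
      L * (𝟏 - x) - x * L
        ≈⟨ +-congˡ (-‿cong (*-congʳ (sym positives-closed))) ⟩
      L * (𝟏 - x) - P * (𝟏 - x) * L
        ≈⟨ solve 3 (λ x l p → l :* (1ₚ :- x) :- p :* (1ₚ :- x) :* l := (l :- p :* l) :* (1ₚ :- x)) refl x L P ⟩
      (L - P * L) * (𝟏 - x)
        ≈⟨ *-congʳ (sub-right labels) ⟩
      x * (𝟏 - x) ∎

    decorations-closed : N * (𝟏 - 𝟐 * x) ≈ x
    decorations-closed = begin
      N * (𝟏 - 𝟐 * x)
        ≈⟨ *-congʳ (trans decorations (+-congˡ (*-congʳ colors))) ⟩
      (x + (𝟏 + 𝟏) * (P * L)) * (𝟏 - 𝟐 * x)
        ≈⟨ solve 3 (λ x p l → (x :+ (1ₚ :+ 1ₚ) :* (p :* l)) :* (1ₚ :- 2ₚ :* x)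
                              := x :* (1ₚ :- 2ₚ :* x) :+ 2ₚ :* p :* (l :* (1ₚ :- 2ₚ :* x))) refl x P L ⟩
      x * (𝟏 - 𝟐 * x) + 𝟐 * P * (L * (𝟏 - 𝟐 * x))
        ≈⟨ +-congˡ (*-congˡ labels-closed) ⟩
      x * (𝟏 - 𝟐 * x) + 𝟐 * P * (x * (𝟏 - x))
        ≈⟨ solve 2 (λ x p → x :* (1ₚ :- 2ₚ :* x) :+ 2ₚ :* p :* (x :* (1ₚ :- x))
                            := x :* (1ₚ :- 2ₚ :* x) :+ 2ₚ :* x :* (p :* (1ₚ :- x))) refl x P ⟩
      x * (𝟏 - 𝟐 * x) + 𝟐 * x * (P * (𝟏 - x))
        ≈⟨ +-congˡ (*-congˡ positives-closed) ⟩
      x * (𝟏 - 𝟐 * x) + 𝟐 * x * x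
        ≈⟨ solve 1 (λ x → x :* (1ₚ :- 2ₚ :* x) :+ 2ₚ :* x :* x := x) refl x ⟩
      x ∎

    children₁-closed : C₁ ≈ T′ * F
    children₁-closed = begin
      C₁
        ≈⟨ solve 1 (λ c → c := c :* 1ₚ) refl C₁ ⟩
      C₁ * 𝟏
        ≈⟨ *-congˡ (sub-right forests) ⟨
      C₁ * (F - T * F)
        ≈⟨ solve 3 (λ c t f → c :* (f :- t :* f) := (c :- t :* c) :* f) refl C₁ T F ⟩
      (C₁ - T * C₁) * F
        ≈⟨ *-congʳ (sub-right children₁) ⟩
      T′ * F ∎

    trees-closed : T * (𝟏 - 𝟐 * x) ≈ x * y * (𝟏 - x) + x * T * (T′ * F)
    trees-closed = begin
      T * (𝟏 - 𝟐 * x)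
        ≈⟨ *-congʳ trees ⟩
      (y * L + N * C) * (𝟏 - 𝟐 * x)
        ≈⟨ solve 5 (λ x y l n c → (y :* l :+ n :* c) :* (1ₚ :- 2ₚ :* x)
                                  := y :* (l :* (1ₚ :- 2ₚ :* x)) :+ n :* (1ₚ :- 2ₚ :* x) :* c) refl x y L N C ⟩
      y * (L * (𝟏 - 𝟐 * x)) + N * (𝟏 - 𝟐 * x) * C
        ≈⟨ +-cong (*-congˡ labels-closed) (*-cong decorations-closed (trans children (*-congˡ children₁-closed))) ⟩
      y * (x * (𝟏 - x)) + x * (T * (T′ * F))
        ≈⟨ solve 5 (λ x y t t′ f → y :* (x :* (1ₚ :- x)) :+ x :* (t :* (t′ :* f))
                                   := x :* y :* (1ₚ :- x) :+ x :* t :* (t′ :* f)) refl x y T T′ F ⟩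
      x * y * (𝟏 - x) + x * T * (T′ * F) ∎

    forests-shifted : F - 𝟏 ≈ T * F
    forests-shifted = sub-left forests

    rightmost-forests : T′ * F ≈ F - 𝟏 - x * y * F
    rightmost-forests = begin
      T′ * F
        ≈⟨ *-congʳ (sub-right rightmost) ⟨
      (T - x * y) * F
        ≈⟨ solve 4 (λ x y t f → (t :- x :* y) :* f := t :* f :- x :* y :* f) refl x y T F ⟩
      T * F - x * y * F
        ≈⟨ +-congʳ forests-shifted ⟨
      F - 𝟏 - x * y * F ∎

    forests-cubic : (F - 𝟏) * (𝟏 - 𝟐 * x) ≈ x * y * (𝟏 - x) * F + x * (F - 𝟏) * (F - 𝟏 - x * y * F)
    forests-cubic = begin
      (F - 𝟏) * (𝟏 - 𝟐 * x)
        ≈⟨ *-congʳ forests-shifted ⟩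
      T * F * (𝟏 - 𝟐 * x)
        ≈⟨ solve 3 (λ x t f → t :* f :* (1ₚ :- 2ₚ :* x) := f :* (t :* (1ₚ :- 2ₚ :* x))) refl x T F ⟩
      F * (T * (𝟏 - 𝟐 * x))
        ≈⟨ *-congˡ trees-closed ⟩
      F * (x * y * (𝟏 - x) + x * T * (T′ * F))
        ≈⟨ solve 5 (λ x y f t t′ → f :* (x :* y :* (1ₚ :- x) :+ x :* t :* (t′ :* f))
                                   := x :* y :* (1ₚ :- x) :* f :+ x :* (t :* f) :* (t′ :* f)) refl x y F T T′ ⟩
      x * y * (𝟏 - x) * F + x * (T * F) * (T′ * F)
        ≈⟨ +-congˡ (*-cong (*-congˡ (sym forests-shifted)) rightmost-forests) ⟩
      x * y * (𝟏 - x) * F + x * (F - 𝟏) * (F - 𝟏 - x * y * F) ∎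

    -- Expanded, (F - x F F) (𝟏 - x y) - (𝟏 - x) is the difference of the two sides of forests-cubic.
    forests-quadratic : (F - x * F * F) * (𝟏 - x * y) ≈ 𝟏 - x
    forests-quadratic = trans
      (solve 3 (λ x y f → (f :- x :* f :* f) :* (1ₚ :- x :* y)
                          := 1ₚ :- x :+ ((f :- 1ₚ) :* (1ₚ :- 2ₚ :* x)
                                         :- (x :* y :* (1ₚ :- x) :* f :+ x :* (f :- 1ₚ) :* (f :- 1ₚ :- x :* y :* f))))
               refl x y F)
      (cancel forests-cubic)

    diagonal-closed : G * (𝟏 - x * y) ≈ 𝟏
    diagonal-closed = begin
      G * (𝟏 - x * y)
        ≈⟨ solve 3 (λ x y g → g :* (1ₚ :- x :* y) := g :- x :* y :* g) refl x y G ⟩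
      G - x * y * G
        ≈⟨ sub-right diagonal ⟩
      𝟏 ∎

    forests-closed : F - x * F * F ≈ (𝟏 - x) * G
    forests-closed = begin
      F - x * F * F
        ≈⟨ solve 2 (λ x f → f :- x :* f :* f := (f :- x :* f :* f) :* 1ₚ) refl x F ⟩
      (F - x * F * F) * 𝟏
        ≈⟨ *-congˡ diagonal-closed ⟨
      (F - x * F * F) * (G * (𝟏 - x * y))
        ≈⟨ solve 4 (λ x y f g → (f :- x :* f :* f) :* (g :* (1ₚ :- x :* y))
                                := (f :- x :* f :* f) :* (1ₚ :- x :* y) :* g) refl x y F G ⟩
      (F - x * F * F) * (𝟏 - x * y) * G
        ≈⟨ *-congʳ forests-quadratic ⟩
      (𝟏 - x) * G ∎

    square-root : (𝟏 - 𝟐 * (x * F)) * (𝟏 - 𝟐 * (x * F)) ≈ 𝟏 - 𝟒 * (x * ((𝟏 - x) * G))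
    square-root = begin
      (𝟏 - 𝟐 * (x * F)) * (𝟏 - 𝟐 * (x * F))
        ≈⟨ solve 2 (λ x f → (1ₚ :- 2ₚ :* (x :* f)) :* (1ₚ :- 2ₚ :* (x :* f))
                            := 1ₚ :- 4ₚ :* (x :* (f :- x :* f :* f))) refl x F ⟩
      𝟏 - 𝟒 * (x * (F - x * F * F))
        ≈⟨ +-congˡ (-‿cong (*-congˡ (*-congˡ forests-closed))) ⟩
      𝟏 - 𝟒 * (x * ((𝟏 - x) * G)) ∎

-- Classes graded by size and number of leaves

open ≡ using (refl; sym; trans; cong; cong₂; subst)

module ∑ℕ = Sums ℕ.+-0-commutativeMonoid
open import Algebra.Properties.CommutativeMonoid.Sum ℕ.+-0-commutativeMonoid using () renaming (sum to sumᵥ)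

Fin-sum↔Σ : ∀ {m} (v : Vector ℕ m) (B : Fin m → Set) → (∀ i → Fin (v i) ↔ B i) → Fin (sumᵥ v) ↔ Σ (Fin m) B
Fin-sum↔Σ {zero}  v B _ = mk↔ₛ′ (λ ()) (λ { (() , _) }) (λ { (() , _) }) (λ ())
Fin-sum↔Σ {suc m} v B v↔B =
  ↔-trans Fin.+↔⊎ (↔-trans (v↔B Fin.zero ⊎-↔ Fin-sum↔Σ (v ∘ Fin.suc) (B ∘ Fin.suc) (v↔B ∘ Fin.suc)) Σ-suc)
  where
  Σ-suc : (B Fin.zero ⊎ Σ (Fin m) (B ∘ Fin.suc)) ↔ Σ (Fin (suc m)) B
  Σ-suc = mk↔ₛ′
    (λ { (inj₁ b) → Fin.zero , b ; (inj₂ (i , b)) → Fin.suc i , b })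
    (λ { (Fin.zero , b) → inj₁ b ; (Fin.suc i , b) → inj₂ (i , b) })
    (λ { (Fin.zero , _) → refl ; (Fin.suc _ , _) → refl })
    (λ { (inj₁ _) → refl ; (inj₂ _) → refl })

indicator : Bool → ℕ
indicator b = if b then 1 else 0

Fin-indicator↔T : ∀ b → Fin (indicator b) ↔ T b
Fin-indicator↔T true  = Fin.1↔⊤
Fin-indicator↔T false = Fin.0↔⊥

∧⁻ : ∀ a {b} → T (a ∧ b) → T a × T b
∧⁻ a = Equivalence.to (T-∧ {a})

∧⁺ : ∀ a {b} → T a → T b → T (a ∧ b)
∧⁺ a p q = Equivalence.from (T-∧ {a}) (p , q)

record Class : Set₁ where
  field
    Obj              : Set
    Valid            : Obj → Set
    Valid-irrelevant : ∀ {o} (p q : Valid o) → p ≡ q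
    size leaves      : Obj → ℕ
open Class public

Elements : Class → ℕ → ℕ → Set
Elements X n k = Σ (Obj X) λ o → Valid X o × size X o ≡ n × leaves X o ≡ k

Elements-≡ : ∀ X {n k} {e e′ : Elements X n k} → proj₁ e ≡ proj₁ e′ → e ≡ e′
Elements-≡ X {e = o , v , p , q} {.o , v′ , p′ , q′} refl
  rewrite Valid-irrelevant X v v′ | ℕ.≡-irrelevant p p′ | ℕ.≡-irrelevant q q′ = refl

record Counts (X : Class) (f : ℕ → ℕ → ℕ) : Set where
  constructor counts
  field enumerate : ∀ n k → Fin (f n k) ↔ Elements X n k
open Counts public

counts-unique : ∀ {X f g} → Counts X f → Counts X g → ∀ n k → f n k ≡ g n k
counts-unique cf cg n k = ↔⇒≡ (↔-trans (enumerate cf n k) (↔-sym (enumerate cg n k)))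

infix 4 _≅_

record _≅_ (X Y : Class) : Set where
  field
    to          : Obj X → Obj Y
    from        : Obj Y → Obj X
    to-valid    : ∀ o → Valid X o → Valid Y (to o)
    from-valid  : ∀ o → Valid Y o → Valid X (from o)
    size-to     : ∀ o → Valid X o → size Y (to o) ≡ size X o
    leaves-to   : ∀ o → Valid X o → leaves Y (to o) ≡ leaves X o
    from-to     : ∀ o → Valid X o → from (to o) ≡ o
    to-from     : ∀ o → Valid Y o → to (from o) ≡ o

≅-sym : ∀ {X Y} → X ≅ Y → Y ≅ X
≅-sym {X} {Y} X≅Y = record
  { to = from ; from = to ; to-valid = from-valid ; from-valid = to-valid
  ; size-to   = λ o v → trans (sym (size-to (from o) (from-valid o v))) (cong (size Y) (to-from o v))
  ; leaves-to = λ o v → trans (sym (leaves-to (from o) (from-valid o v))) (cong (leaves Y) (to-from o v))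
  ; from-to = to-from ; to-from = from-to }
  where open _≅_ X≅Y

≅-transport : ∀ {X Y} → X ≅ Y → ∀ {n k} → Elements X n k → Elements Y n k
≅-transport X≅Y (o , v , p , q) = to o , to-valid o v , trans (size-to o v) p , trans (leaves-to o v) q
  where open _≅_ X≅Y

≅-elements : ∀ {X Y} → X ≅ Y → ∀ n k → Elements X n k ↔ Elements Y n k
≅-elements {X} {Y} X≅Y n k = mk↔ₛ′ (≅-transport X≅Y) (≅-transport (≅-sym X≅Y))
  (λ (o , v , _) → Elements-≡ Y (to-from o v)) (λ (o , v , _) → Elements-≡ X (from-to o v))
  where open _≅_ X≅Y

≅-counts : ∀ {X Y f} → X ≅ Y → Counts Y f → Counts X f
≅-counts X≅Y cf = counts λ n k → ↔-trans (enumerate cf n k) (≅-elements (≅-sym X≅Y) n k)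

infixr 5 _⊎ᶜ_ _+ᶜ_
infixr 6 _×ᶜ_ _✶_

_⊎ᶜ_ : Class → Class → Class
X ⊎ᶜ Y = record
  { Obj              = Obj X ⊎ Obj Y
  ; Valid            = λ { (inj₁ o) → Valid X o ; (inj₂ o) → Valid Y o }
  ; Valid-irrelevant = λ { {inj₁ _} → Valid-irrelevant X ; {inj₂ _} → Valid-irrelevant Y }
  ; size             = λ { (inj₁ o) → size X o ; (inj₂ o) → size Y o }
  ; leaves           = λ { (inj₁ o) → leaves X o ; (inj₂ o) → leaves Y o }
  }

⊎ᶜ-elements : ∀ X Y n k → (Elements X n k ⊎ Elements Y n k) ↔ Elements (X ⊎ᶜ Y) n k
⊎ᶜ-elements X Y n k = mk↔ₛ′
  (λ { (inj₁ (o , e)) → inj₁ o , e ; (inj₂ (o , e)) → inj₂ o , e })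
  (λ { (inj₁ o , e) → inj₁ (o , e) ; (inj₂ o , e) → inj₂ (o , e) })
  (λ { (inj₁ _ , _) → refl ; (inj₂ _ , _) → refl })
  (λ { (inj₁ _) → refl ; (inj₂ _) → refl })

_+ᶜ_ : (ℕ → ℕ → ℕ) → (ℕ → ℕ → ℕ) → ℕ → ℕ → ℕ
(f +ᶜ g) n k = f n k ℕ.+ g n k

⊎ᶜ-counts : ∀ {X Y f g} → Counts X f → Counts Y g → Counts (X ⊎ᶜ Y) (f +ᶜ g)
⊎ᶜ-counts {X} {Y} cf cg = counts λ n k →
  ↔-trans Fin.+↔⊎ (↔-trans (enumerate cf n k ⊎-↔ enumerate cg n k) (⊎ᶜ-elements X Y n k))

_×ᶜ_ : Class → Class → Class
X ×ᶜ Y = record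
  { Obj              = Obj X × Obj Y
  ; Valid            = λ (a , b) → Valid X a × Valid Y b
  ; Valid-irrelevant = λ (p , q) (p′ , q′) → cong₂ _,_ (Valid-irrelevant X p p′) (Valid-irrelevant Y q q′)
  ; size             = λ (a , b) → size X a ℕ.+ size Y b
  ; leaves           = λ (a , b) → leaves X a ℕ.+ leaves Y b
  }

_✶_ : (ℕ → ℕ → ℕ) → (ℕ → ℕ → ℕ) → ℕ → ℕ → ℕ
(f ✶ g) n k = ∑ℕ.∑≤ n (λ i → ∑ℕ.∑≤ k (λ j → f i j ℕ.* g (n ∸ i) (k ∸ j)))

Splittings : Class → Class → ℕ → ℕ → Set
Splittings X Y n k = Σ (Fin (suc n)) λ i → Σ (Fin (suc k)) λ j →
  Elements X (toℕ i) (toℕ j) × Elements Y (n ∸ toℕ i) (k ∸ toℕ j)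

×ᶜ-elements : ∀ X Y n k → Splittings X Y n k ↔ Elements (X ×ᶜ Y) n k
×ᶜ-elements X Y n k = mk↔ₛ′ join split (λ _ → Elements-≡ (X ×ᶜ Y) refl) split-join
  where
  join : Splittings X Y n k → Elements (X ×ᶜ Y) n k
  join (i , j , (a , va , pa , qa) , (b , vb , pb , qb)) =
    (a , b) , (va , vb) ,
    trans (cong₂ ℕ._+_ pa pb) (ℕ.m+[n∸m]≡n (Fin.toℕ≤pred[n] i)) ,
    trans (cong₂ ℕ._+_ qa qb) (ℕ.m+[n∸m]≡n (Fin.toℕ≤pred[n] j))
  first-part : ∀ x y {m} → x ℕ.+ y ≡ m → x < suc m
  first-part x y x+y≡m = s≤s (subst (x ≤_) x+y≡m (ℕ.m≤m+n x y))
  second-part : ∀ x y {m} (x+y≡m : x ℕ.+ y ≡ m) → y ≡ m ∸ toℕ (fromℕ< (first-part x y x+y≡m))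
  second-part x y x+y≡m =
    trans (sym (ℕ.m+n∸m≡n x y)) (cong₂ _∸_ x+y≡m (sym (Fin.toℕ-fromℕ< (first-part x y x+y≡m))))
  split : Elements (X ×ᶜ Y) n k → Splittings X Y n k
  split ((a , b) , (va , vb) , p , q) =
    fromℕ< (first-part (size X a) (size Y b) p) , fromℕ< (first-part (leaves X a) (leaves Y b) q) ,
    (a , va , sym (Fin.toℕ-fromℕ< _) , sym (Fin.toℕ-fromℕ< _)) ,
    (b , vb , second-part (size X a) (size Y b) p , second-part (leaves X a) (leaves Y b) q)
  same-objects : ∀ {i i′ j j′ ea ea′ eb eb′} → i ≡ i′ → j ≡ j′ → proj₁ ea ≡ proj₁ ea′ → proj₁ eb ≡ proj₁ eb′ →
                 _≡_ {A = Splittings X Y n k} (i , j , ea , eb) (i′ , j′ , ea′ , eb′)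
  same-objects {i} {j = j} refl refl a≡a′ b≡b′ =
    cong₂ (λ ea eb → i , j , ea , eb) (Elements-≡ X a≡a′) (Elements-≡ Y b≡b′)
  split-join : ∀ s → split (join s) ≡ s
  split-join (i , j , (a , va , pa , qa) , (b , vb , pb , qb)) =
    same-objects (Fin.toℕ-injective (trans (Fin.toℕ-fromℕ< _) pa)) (Fin.toℕ-injective (trans (Fin.toℕ-fromℕ< _) qa))
                 refl refl

×ᶜ-counts : ∀ {X Y f g} → Counts X f → Counts Y g → Counts (X ×ᶜ Y) (f ✶ g)
×ᶜ-counts {X} {Y} cf cg = counts λ n k → ↔-trans
  (Fin-sum↔Σ _ _ λ i → Fin-sum↔Σ _ _ λ j →
     ↔-trans Fin.*↔× (enumerate cf (toℕ i) (toℕ j) ×-↔ enumerate cg (n ∸ toℕ i) (k ∸ toℕ j)))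
  (×ᶜ-elements X Y n k)

decidableClass : (A : Set) → (A → Bool) → (size leaves : A → ℕ) → Class
decidableClass A p size leaves =
  record { Obj = A ; Valid = T ∘ p ; Valid-irrelevant = T-irrelevant ; size = size ; leaves = leaves }

atom : ℕ → ℕ → Class
atom a b = decidableClass ⊤ (λ _ → true) (λ _ → a) (λ _ → b)

monomial : ℕ → ℕ → ℕ → ℕ → ℕ
monomial a b n k = indicator ((n ≡ᵇ a) ∧ (k ≡ᵇ b))

atom-counts : ∀ a b → Counts (atom a b) (monomial a b)
atom-counts a b = counts λ n k → ↔-trans (Fin-indicator↔T ((n ≡ᵇ a) ∧ (k ≡ᵇ b))) (mk↔ₛ′
  (λ t → let n≡a , k≡b = ∧⁻ (n ≡ᵇ a) t in tt , tt , sym (ℕ.≡ᵇ⇒≡ n a n≡a) , sym (ℕ.≡ᵇ⇒≡ k b k≡b))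
  (λ (_ , _ , a≡n , b≡k) → ∧⁺ (n ≡ᵇ a) (ℕ.≡⇒≡ᵇ n a (sym a≡n)) (ℕ.≡⇒≡ᵇ k b (sym b≡k)))
  (λ _ → Elements-≡ (atom a b) refl)
  (λ _ → T-irrelevant _ _))

infixl 7 _∣_

_∣_ : (X : Class) → (Obj X → Bool) → Class
X ∣ p = record
  { Obj              = Obj X
  ; Valid            = λ o → Valid X o × T (p o)
  ; Valid-irrelevant = λ (v , t) (v′ , t′) → cong₂ _,_ (Valid-irrelevant X v v′) (T-irrelevant t t′)
  ; size             = size X
  ; leaves           = leaves X
  }

∣-count : ∀ {X f} → Counts X f → (Obj X → Bool) → ℕ → ℕ → ℕ
∣-count cf p n k = sumᵥ (λ i → indicator (p (proj₁ (Inverse.to (enumerate cf n k) i))))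

∣-counts : ∀ {X f} (cf : Counts X f) p → Counts (X ∣ p) (∣-count cf p)
∣-counts cf p = counts λ n k →
  ↔-trans (Fin-sum↔Σ _ _ (λ i → Fin-indicator↔T (p (proj₁ (Inverse.to (enumerate cf n k) i)))))
  (↔-trans (Σ-↔ (enumerate cf n k) ↔-refl) (mk↔ₛ′
    (λ ((o , v , s) , t) → o , (v , t) , s) (λ (o , (v , t) , s) → (o , v , s) , t) (λ _ → refl) (λ _ → refl)))

withLeaf : Class → Class
withLeaf X = record
  { Obj = Obj X ; Valid = Valid X ; Valid-irrelevant = Valid-irrelevant X ; size = size X ; leaves = suc ∘ leaves X }

withLeaf-counts : ∀ {X f} → Counts (withLeaf X) f → Counts X (λ n k → f n (suc k))
withLeaf-counts {X} cf = counts λ n k → ↔-trans (enumerate cf n (suc k)) (mk↔ₛ′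
  (λ (o , v , p , q) → o , v , p , ℕ.suc-injective q)
  (λ (o , v , p , q) → o , v , p , cong suc q)
  (λ _ → Elements-≡ X refl) (λ _ → Elements-≡ (withLeaf X) refl))

-- LCO forests and their decompositions

open import Defs

validTree⁻ : ∀ c m ts → T (validTree (node c m ts)) →
  T (isLabel c) × T (colorOK ts (sum c) m) × T (notOneChild ts) × T (rightmostOK ts) × T (validForest ts)
validTree⁻ c m ts v =
  let l , v₁ = ∧⁻ (isLabel c) v
      o , v₂ = ∧⁻ (colorOK ts (sum c) m) v₁
      n , v₃ = ∧⁻ (notOneChild ts) v₂
  in l , o , n , ∧⁻ (rightmostOK ts) v₃

validTree⁺ : ∀ c m ts → T (isLabel c) → T (colorOK ts (sum c) m) → T (notOneChild ts) → T (rightmostOK ts) →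
  T (validForest ts) → T (validTree (node c m ts))
validTree⁺ c m ts l o n r f =
  ∧⁺ (isLabel c) l (∧⁺ (colorOK ts (sum c) m) o (∧⁺ (notOneChild ts) n (∧⁺ (rightmostOK ts) r f)))

isLabel-cons⁻ : ∀ x y r → T (isLabel (x ∷ y ∷ r)) → T (1 ≤ᵇ x) × T (isLabel (y ∷ r))
isLabel-cons⁻ x y r v =
  let pos , last = ∧⁻ (allPos (x ∷ y ∷ r)) v
      x≥1 , pos′ = ∧⁻ (1 ≤ᵇ x) pos
  in x≥1 , ∧⁺ (allPos (y ∷ r)) pos′ last

isLabel-cons⁺ : ∀ x y r → T (1 ≤ᵇ x) → T (isLabel (y ∷ r)) → T (isLabel (x ∷ y ∷ r))
isLabel-cons⁺ x y r x≥1 v =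
  let pos , last = ∧⁻ (allPos (y ∷ r)) v
  in ∧⁺ (allPos (x ∷ y ∷ r)) (∧⁺ (1 ≤ᵇ x) x≥1 pos) last

isLabel-cons⇒size≥2 : ∀ x y r → T (isLabel (x ∷ y ∷ r)) → T (2 ≤ᵇ sum (x ∷ y ∷ r))
isLabel-cons⇒size≥2 zero    y       r v = ⊥-elim (proj₁ (isLabel-cons⁻ zero y r v))
isLabel-cons⇒size≥2 (suc x) zero    r v = ⊥-elim (proj₂ (isLabel-cons⁻ (suc x) zero r v))
isLabel-cons⇒size≥2 (suc x) (suc y) r v = ℕ.≤⇒≤ᵇ (s≤s (ℕ.≤-trans (s≤s z≤n) (ℕ.m≤n+m (suc (y ℕ.+ sum r)) x)))

nothing-unique : ∀ {m : Maybe Color} → T (is-nothing m) → m ≡ nothing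
nothing-unique {nothing} _ = refl

-- colorOK (t ∷ ts) s m reduces to internalColorOK s m.
internalColorOK : ℕ → Maybe Color → Bool
internalColorOK s m = if 2 ≤ᵇ s then is-just m else is-nothing m

isSingleton : List RTree → Bool
isSingleton (_ ∷ []) = true
isSingleton _        = false

isLeaf : RTree → Bool
isLeaf (node _ _ []) = true
isLeaf (node _ _ (_ ∷ _)) = false

isChildList : List RTree → Bool
isChildList []              = false
isChildList (_ ∷ [])        = false
isChildList ts@(_ ∷ _ ∷ _)  = rightmostOK ts

isChildTail : List RTree → Bool
isChildTail []          = false
isChildTail ts@(_ ∷ _)  = rightmostOK ts

forests trees rightmostTrees childLists childTails labels leafVertices positives decorations colors diagonal : Class
forests        = decidableClass (List RTree) validForest sizeF leavesF
trees          = decidableClass RTree validTree sizeT leavesT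
rightmostTrees = trees ∣ leafOK
childLists     = forests ∣ isChildList
childTails     = forests ∣ isChildTail
labels         = decidableClass (List ℕ) isLabel sum (λ _ → 0)
leafVertices   = withLeaf labels
positives      = decidableClass ℕ (1 ≤ᵇ_) (λ e → e) (λ _ → 0)
decorations    = decidableClass (List ℕ × Maybe Color) (λ (c , m) → isLabel c ∧ internalColorOK (sum c) m)
                                (λ (c , _) → sum c) (λ _ → 0)
colors         = decidableClass Color (λ _ → true) (λ _ → 0) (λ _ → 0)
diagonal       = decidableClass ℕ (λ _ → true) (λ m → m) (λ m → m)

junkTree : RTree
junkTree = node [] nothing []

forests≅ : forests ≅ atom 0 0 ⊎ᶜ trees ×ᶜ forests
forests≅ = record
  { to         = λ { [] → inj₁ tt ; (t ∷ f) → inj₂ (t , f) }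
  ; from       = λ { (inj₁ _) → [] ; (inj₂ (t , f)) → t ∷ f }
  ; to-valid   = λ { [] _ → tt ; (t ∷ f) v → ∧⁻ (validTree t) v }
  ; from-valid = λ { (inj₁ _) _ → tt ; (inj₂ (t , f)) (vt , vf) → ∧⁺ (validTree t) vt vf }
  ; size-to    = λ { [] _ → refl ; (t ∷ f) _ → refl }
  ; leaves-to  = λ { [] _ → refl ; (t ∷ f) _ → refl }
  ; from-to    = λ { [] _ → refl ; (t ∷ f) _ → refl }
  ; to-from    = λ { (inj₁ tt) _ → refl ; (inj₂ (t , f)) _ → refl }
  }

trees≅singletons : trees ≅ forests ∣ isSingleton
trees≅singletons = record
  { to         = λ t → t ∷ []
  ; from       = λ { (t ∷ _) → t ; [] → junkTree }
  ; to-valid   = λ t v → ∧⁺ (validTree t) v tt , tt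
  ; from-valid = λ { (t ∷ []) (v , _) → proj₁ (∧⁻ (validTree t) v) ; [] (_ , ()) ; (_ ∷ _ ∷ _) (_ , ()) }
  ; size-to    = λ t _ → ℕ.+-identityʳ (sizeT t)
  ; leaves-to  = λ t _ → ℕ.+-identityʳ (leavesT t)
  ; from-to    = λ t _ → refl
  ; to-from    = λ { (t ∷ []) _ → refl ; [] (_ , ()) ; (_ ∷ _ ∷ _) (_ , ()) }
  }

trees≅ : trees ≅ leafVertices ⊎ᶜ decorations ×ᶜ childLists
trees≅ = record
  { to = to ; from = from ; to-valid = to-valid ; from-valid = from-valid
  ; size-to = size-to ; leaves-to = leaves-to ; from-to = from-to ; to-from = to-from }
  where
  Parts : Class
  Parts = leafVertices ⊎ᶜ decorations ×ᶜ childLists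
  to : RTree → Obj Parts
  to (node c m [])         = inj₁ c
  to (node c m ts@(_ ∷ _)) = inj₂ ((c , m) , ts)
  from : Obj Parts → RTree
  from (inj₁ c)              = node c nothing []
  from (inj₂ ((c , m) , ts)) = node c m ts
  to-valid : ∀ t → Valid trees t → Valid Parts (to t)
  to-valid (node c m []) v             = proj₁ (validTree⁻ c m [] v)
  to-valid (node c m (t ∷ [])) v       = ⊥-elim (proj₁ (proj₂ (proj₂ (validTree⁻ c m (t ∷ []) v))))
  to-valid (node c m ts@(_ ∷ _ ∷ _)) v = let l , o , _ , rm , f = validTree⁻ c m ts v in ∧⁺ (isLabel c) l o , f , rm
  from-valid : ∀ o → Valid Parts o → Valid trees (from o)
  from-valid (inj₁ c) v = validTree⁺ c nothing [] v tt tt tt tt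
  from-valid (inj₂ ((c , m) , ts@(_ ∷ _ ∷ _))) (lo , f , rm) =
    let l , o = ∧⁻ (isLabel c) lo in validTree⁺ c m ts l o tt rm f
  size-to : ∀ t → Valid trees t → size Parts (to t) ≡ sizeT t
  size-to (node c m []) _      = sym (ℕ.+-identityʳ (sum c))
  size-to (node c m (_ ∷ _)) _ = refl
  leaves-to : ∀ t → Valid trees t → leaves Parts (to t) ≡ leavesT t
  leaves-to (node c m []) _      = refl
  leaves-to (node c m (_ ∷ _)) _ = refl
  from-to : ∀ t → Valid trees t → from (to t) ≡ t
  from-to (node c m []) v      = cong (λ m → node c m []) (sym (nothing-unique (proj₁ (proj₂ (validTree⁻ c m [] v)))))
  from-to (node c m (_ ∷ _)) _ = refl
  to-from : ∀ o → Valid Parts o → to (from o) ≡ o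
  to-from (inj₁ c) _                 = refl
  to-from (inj₂ ((c , m) , _ ∷ _)) _ = refl

childLists≅ : childLists ≅ trees ×ᶜ childTails
childLists≅ = record
  { to         = λ { [] → junkTree , [] ; (t ∷ ts) → t , ts }
  ; from       = λ (t , ts) → t ∷ ts
  ; to-valid   = λ { (t ∷ ts@(_ ∷ _)) (v , rm) → let vt , vts = ∧⁻ (validTree t) v in vt , vts , rm }
  ; from-valid = λ { (t , ts@(_ ∷ _)) (vt , vts , rm) → ∧⁺ (validTree t) vt vts , rm }
  ; size-to    = λ { (_ ∷ _ ∷ _) _ → refl }
  ; leaves-to  = λ { (_ ∷ _ ∷ _) _ → refl }
  ; from-to    = λ { (_ ∷ _ ∷ _) _ → refl }
  ; to-from    = λ _ _ → refl
  }

childTails≅ : childTails ≅ rightmostTrees ⊎ᶜ trees ×ᶜ childTails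
childTails≅ = record
  { to         = λ { [] → inj₁ junkTree ; (t ∷ []) → inj₁ t ; (t ∷ ts@(_ ∷ _)) → inj₂ (t , ts) }
  ; from       = λ { (inj₁ t) → t ∷ [] ; (inj₂ (t , ts)) → t ∷ ts }
  ; to-valid   = λ { (t ∷ []) (v , rm) → proj₁ (∧⁻ (validTree t) v) , rm
                   ; (t ∷ ts@(_ ∷ _)) (v , rm) → let vt , vts = ∧⁻ (validTree t) v in vt , vts , rm }
  ; from-valid = λ { (inj₁ t) (vt , rm) → ∧⁺ (validTree t) vt tt , rm
                   ; (inj₂ (t , ts@(_ ∷ _))) (vt , vts , rm) → ∧⁺ (validTree t) vt vts , rm }
  ; size-to    = λ { (t ∷ []) _ → sym (ℕ.+-identityʳ (sizeT t)) ; (_ ∷ _ ∷ _) _ → refl }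
  ; leaves-to  = λ { (t ∷ []) _ → sym (ℕ.+-identityʳ (leavesT t)) ; (_ ∷ _ ∷ _) _ → refl }
  ; from-to    = λ { (_ ∷ []) _ → refl ; (_ ∷ _ ∷ _) _ → refl }
  ; to-from    = λ { (inj₁ _) _ → refl ; (inj₂ (_ , _ ∷ _)) _ → refl }
  }

¬leafOK⇒leaf₁ : ∀ t → T (validTree t) → leafOK t ≡ false → t ≡ node (1 ∷ []) nothing []
¬leafOK⇒leaf₁ (node (x ∷ []) m []) v _ with x | validTree⁻ (x ∷ []) m [] v
... | suc zero | _ , col , _ = cong (λ m → node (1 ∷ []) m []) (nothing-unique col)
¬leafOK⇒leaf₁ (node (x ∷ y ∷ r) m []) v ¬ok =
  ⊥-elim (subst T ¬ok (isLabel-cons⇒size≥2 x y r (proj₁ (validTree⁻ (x ∷ y ∷ r) m [] v))))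

trees≅rightmost : trees ≅ rightmostTrees ⊎ᶜ atom 1 1
trees≅rightmost = record
  { to = to ; from = from
  ; to-valid = to-valid ; from-valid = λ { (inj₁ t) (v , _) → v ; (inj₂ _) _ → tt }
  ; size-to = size-to ; leaves-to = leaves-to ; from-to = from-to ; to-from = to-from }
  where
  Parts : Class
  Parts = rightmostTrees ⊎ᶜ atom 1 1
  to : RTree → Obj Parts
  to t with leafOK t
  ... | true  = inj₁ t
  ... | false = inj₂ tt
  from : Obj Parts → RTree
  from (inj₁ t) = t
  from (inj₂ _) = node (1 ∷ []) nothing []
  to-valid : ∀ t → Valid trees t → Valid Parts (to t)
  to-valid t v with leafOK t in ok
  ... | true  = v , subst T (sym ok) tt
  ... | false = tt
  size-to : ∀ t → Valid trees t → size Parts (to t) ≡ sizeT t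
  size-to t v with leafOK t in ok
  ... | true  = refl
  ... | false = sym (cong sizeT (¬leafOK⇒leaf₁ t v ok))
  leaves-to : ∀ t → Valid trees t → leaves Parts (to t) ≡ leavesT t
  leaves-to t v with leafOK t in ok
  ... | true  = refl
  ... | false = sym (cong leavesT (¬leafOK⇒leaf₁ t v ok))
  from-to : ∀ t → Valid trees t → from (to t) ≡ t
  from-to t v with leafOK t in ok
  ... | true  = refl
  ... | false = sym (¬leafOK⇒leaf₁ t v ok)
  to-from : ∀ o → Valid Parts o → to (from o) ≡ o
  to-from (inj₁ t) (_ , ok) with leafOK t
  ... | true = refl
  to-from (inj₂ tt) _ = refl

leafVertices≅leaves : leafVertices ≅ trees ∣ isLeaf
leafVertices≅leaves = record
  { to         = λ c → node c nothing []
  ; from       = λ { (node c _ _) → c }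
  ; to-valid   = λ c v → validTree⁺ c nothing [] v tt tt tt tt , tt
  ; from-valid = λ { (node c m ts) (v , _) → proj₁ (validTree⁻ c m ts v) }
  ; size-to    = λ c _ → ℕ.+-identityʳ (sum c)
  ; leaves-to  = λ c _ → refl
  ; from-to    = λ c _ → refl
  ; to-from    = λ { (node c m []) (v , _) →
                       cong (λ m → node c m []) (sym (nothing-unique (proj₁ (proj₂ (validTree⁻ c m [] v))))) }
  }

leafVertices≅ : leafVertices ≅ atom 0 1 ×ᶜ labels
leafVertices≅ = record
  { to = λ c → tt , c ; from = proj₂ ; to-valid = λ _ v → tt , v ; from-valid = λ _ → proj₂
  ; size-to = λ _ _ → refl ; leaves-to = λ _ _ → refl ; from-to = λ _ _ → refl ; to-from = λ _ _ → refl }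

labels≅ : labels ≅ atom 1 0 ⊎ᶜ positives ×ᶜ labels
labels≅ = record
  { to         = λ { (x ∷ y ∷ r) → inj₂ (x , y ∷ r) ; _ → inj₁ tt }
  ; from       = λ { (inj₁ _) → 1 ∷ [] ; (inj₂ (x , r)) → x ∷ r }
  ; to-valid   = λ { (x ∷ []) _ → tt ; (x ∷ y ∷ r) v → isLabel-cons⁻ x y r v }
  ; from-valid = λ { (inj₁ _) _ → tt ; (inj₂ (x , y ∷ r)) (x≥1 , v) → isLabel-cons⁺ x y r x≥1 v }
  ; size-to    = λ { (suc zero ∷ []) _ → refl ; (_ ∷ _ ∷ _) _ → refl }
  ; leaves-to  = λ { (_ ∷ []) _ → refl ; (_ ∷ _ ∷ _) _ → refl }
  ; from-to    = λ { (suc zero ∷ []) _ → refl ; (_ ∷ _ ∷ _) _ → refl }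
  ; to-from    = λ { (inj₁ tt) _ → refl ; (inj₂ (_ , _ ∷ _)) _ → refl }
  }

positives≅ : positives ≅ atom 1 0 ⊎ᶜ atom 1 0 ×ᶜ positives
positives≅ = record
  { to         = λ { (suc (suc e)) → inj₂ (tt , suc e) ; _ → inj₁ tt }
  ; from       = λ { (inj₁ _) → 1 ; (inj₂ (_ , e)) → suc e }
  ; to-valid   = λ { (suc zero) _ → tt ; (suc (suc e)) _ → tt , tt }
  ; from-valid = λ { (inj₁ _) _ → tt ; (inj₂ _) _ → tt }
  ; size-to    = λ { (suc zero) _ → refl ; (suc (suc e)) _ → refl }
  ; leaves-to  = λ { (suc zero) _ → refl ; (suc (suc e)) _ → refl }
  ; from-to    = λ { (suc zero) _ → refl ; (suc (suc e)) _ → refl }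
  ; to-from    = λ { (inj₁ tt) _ → refl ; (inj₂ (tt , suc e)) _ → refl }
  }

internalColorOK-just : ∀ s m → T (2 ≤ᵇ s) → T (internalColorOK s m) → T (is-just m)
internalColorOK-just s m s≥2 ok with 2 ≤ᵇ s
... | true = ok

internalColorOK-intro : ∀ s col → T (2 ≤ᵇ s) → T (internalColorOK s (just col))
internalColorOK-intro s col s≥2 with 2 ≤ᵇ s
... | true = tt

long-label-uncolored : ∀ x y r → T (isLabel (x ∷ y ∷ r) ∧ internalColorOK (sum (x ∷ y ∷ r)) nothing) → ⊥
long-label-uncolored x y r v =
  let l , ok = ∧⁻ (isLabel (x ∷ y ∷ r)) v
  in internalColorOK-just (sum (x ∷ y ∷ r)) nothing (isLabel-cons⇒size≥2 x y r l) ok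

decorations≅ : decorations ≅ atom 1 0 ⊎ᶜ colors ×ᶜ positives ×ᶜ labels
decorations≅ = record
  { to = to ; from = from ; to-valid = to-valid ; from-valid = from-valid
  ; size-to = size-to ; leaves-to = leaves-to ; from-to = from-to ; to-from = to-from }
  where
  Parts : Class
  Parts = atom 1 0 ⊎ᶜ colors ×ᶜ positives ×ᶜ labels
  to : List ℕ × Maybe Color → Obj Parts
  to (x ∷ y ∷ r , just col) = inj₂ (col , x , y ∷ r)
  to _                      = inj₁ tt
  from : Obj Parts → List ℕ × Maybe Color
  from (inj₁ _)             = 1 ∷ [] , nothing
  from (inj₂ (col , x , r)) = x ∷ r , just col
  to-valid : ∀ d → Valid decorations d → Valid Parts (to d)
  to-valid (_ ∷ [] , _)           _ = tt
  to-valid (x ∷ y ∷ r , nothing)  v = ⊥-elim (long-label-uncolored x y r v)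
  to-valid (x ∷ y ∷ r , just col) v = tt , isLabel-cons⁻ x y r (proj₁ (∧⁻ (isLabel (x ∷ y ∷ r)) v))
  from-valid : ∀ d → Valid Parts d → Valid decorations (from d)
  from-valid (inj₁ _)                   _             = tt
  from-valid (inj₂ (col , x , y ∷ r))   (_ , x≥1 , v) =
    let l = isLabel-cons⁺ x y r x≥1 v
    in ∧⁺ (isLabel (x ∷ y ∷ r)) l (internalColorOK-intro (sum (x ∷ y ∷ r)) col (isLabel-cons⇒size≥2 x y r l))
  size-to : ∀ d → Valid decorations d → size Parts (to d) ≡ size decorations d
  size-to (suc zero ∷ [] , _)     _ = refl
  size-to (x ∷ y ∷ r , nothing)   v = ⊥-elim (long-label-uncolored x y r v)
  size-to (x ∷ y ∷ r , just col)  _ = refl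
  leaves-to : ∀ d → Valid decorations d → leaves Parts (to d) ≡ 0
  leaves-to (_ ∷ [] , _)          _ = refl
  leaves-to (x ∷ y ∷ r , nothing) v = ⊥-elim (long-label-uncolored x y r v)
  leaves-to (x ∷ y ∷ r , just _)  _ = refl
  from-to : ∀ d → Valid decorations d → from (to d) ≡ d
  from-to (suc zero ∷ [] , m)     v = cong (1 ∷ [] ,_) (sym (nothing-unique (proj₂ (∧⁻ (isLabel (1 ∷ [])) v))))
  from-to (x ∷ y ∷ r , nothing)   v = ⊥-elim (long-label-uncolored x y r v)
  from-to (x ∷ y ∷ r , just col)  _ = refl
  to-from : ∀ d → Valid Parts d → to (from d) ≡ d
  to-from (inj₁ tt)              _ = refl
  to-from (inj₂ (_ , _ , _ ∷ _)) _ = refl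

colors≅ : colors ≅ atom 0 0 ⊎ᶜ atom 0 0
colors≅ = record
  { to = λ { top → inj₁ tt ; bot → inj₂ tt } ; from = λ { (inj₁ _) → top ; (inj₂ _) → bot }
  ; to-valid = λ { top _ → tt ; bot _ → tt } ; from-valid = λ { (inj₁ _) _ → tt ; (inj₂ _) _ → tt }
  ; size-to = λ { top _ → refl ; bot _ → refl } ; leaves-to = λ { top _ → refl ; bot _ → refl }
  ; from-to = λ { top _ → refl ; bot _ → refl } ; to-from = λ { (inj₁ tt) _ → refl ; (inj₂ tt) _ → refl } }

diagonal≅ : diagonal ≅ atom 0 0 ⊎ᶜ atom 1 1 ×ᶜ diagonal
diagonal≅ = record
  { to = λ { zero → inj₁ tt ; (suc m) → inj₂ (tt , m) } ; from = λ { (inj₁ _) → zero ; (inj₂ (_ , m)) → suc m }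
  ; to-valid = λ { zero _ → tt ; (suc m) _ → tt , tt } ; from-valid = λ { (inj₁ _) _ → tt ; (inj₂ _) _ → tt }
  ; size-to = λ { zero _ → refl ; (suc m) _ → refl } ; leaves-to = λ { zero _ → refl ; (suc m) _ → refl }
  ; from-to = λ { zero _ → refl ; (suc m) _ → refl } ; to-from = λ { (inj₁ tt) _ → refl ; (inj₂ (tt , m)) _ → refl } }

atom₁₁≅ : atom 1 1 ≅ atom 1 0 ×ᶜ atom 0 1
atom₁₁≅ = record
  { to = λ _ → tt , tt ; from = λ _ → tt ; to-valid = λ _ _ → tt , tt ; from-valid = λ _ _ → tt
  ; size-to = λ _ _ → refl ; leaves-to = λ _ _ → refl ; from-to = λ _ _ → refl ; to-from = λ _ _ → refl }

#positives : ℕ → ℕ → ℕ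
#positives n k = indicator ((k ℕ.≡ᵇ 0) ∧ (1 ≤ᵇ n))

positives-counts : Counts positives #positives
positives-counts = counts λ n k → ↔-trans (Fin-indicator↔T ((k ℕ.≡ᵇ 0) ∧ (1 ≤ᵇ n))) (mk↔ₛ′
  (λ t → let k≡0 , n≥1 = ∧⁻ (k ℕ.≡ᵇ 0) t in n , n≥1 , refl , sym (ℕ.≡ᵇ⇒≡ k 0 k≡0))
  (λ (e , e≥1 , e≡n , 0≡k) → ∧⁺ (k ℕ.≡ᵇ 0) (ℕ.≡⇒≡ᵇ k 0 (sym 0≡k)) (subst (T ∘ (1 ≤ᵇ_)) e≡n e≥1))
  (λ (e , _ , e≡n , _) → Elements-≡ positives (sym e≡n))
  (λ _ → T-irrelevant _ _))

#diagonal : ℕ → ℕ → ℕ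
#diagonal n k = indicator (n ℕ.≡ᵇ k)

diagonal-counts : Counts diagonal #diagonal
diagonal-counts = counts λ n k → ↔-trans (Fin-indicator↔T (n ℕ.≡ᵇ k)) (mk↔ₛ′
  (λ t → n , tt , refl , ℕ.≡ᵇ⇒≡ n k t)
  (λ (m , _ , m≡n , m≡k) → ℕ.≡⇒≡ᵇ n k (trans (sym m≡n) m≡k))
  (λ (m , _ , m≡n , _) → Elements-≡ diagonal (sym m≡n))
  (λ _ → T-irrelevant _ _))

-- Generating functions in ℤ[[x,y]]

-- ℤ[[x,y]] is ℤ[[y]][[x]], whose equality is Defs._≈_ by definition.
module ℤ[[y]]   = PowerSeries ℤ.+-*-commutativeRing
module ℤ[[x,y]] = PowerSeries ℤ[[y]].commutativeRing
module S = CommutativeRing ℤ[[x,y]].commutativeRing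

ℤ→ℤ[[x,y]] : ℤ.+-*-rawRing -Raw-AlmostCommutative⟶ fromCommutativeRing ℤ[[x,y]].commutativeRing
ℤ→ℤ[[x,y]] =
  ℤ[[x,y]].constant-morphism (ℤ[[y]].constant-morphism (-raw-almostCommutative⟶ (fromCommutativeRing ℤ.+-*-commutativeRing)))

open LCOSystem ℤ[[x,y]].commutativeRing ℤ→ℤ[[x,y]] using (𝟏; 𝟐; 𝟒; square-root)

module ∑ℤ = Sums (CommutativeRing.+-commutativeMonoid ℤ.+-*-commutativeRing)
module ∑ℤ[[y]] = Sums (CommutativeRing.+-commutativeMonoid ℤ[[y]].commutativeRing)

sumℤ-applyUpTo : ∀ n (g : ℕ → ℕ) (f : ℕ → ℤ) → sumℤ (map f (applyUpTo g (suc n))) ≡ ∑ℤ.∑≤ n (f ∘ g)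
sumℤ-applyUpTo zero    g f = refl
sumℤ-applyUpTo (suc n) g f = cong (λ s → f (g 0) ℤ.+ s) (sumℤ-applyUpTo n (g ∘ suc) f)

coefficient-∑≤ : ∀ n (v : ℕ → ℤ[[y]].Series) k → ∑ℤ[[y]].∑≤ n v k ≡ ∑ℤ.∑≤ n (λ i → v i k)
coefficient-∑≤ zero    v k = refl
coefficient-∑≤ (suc n) v k = cong (λ s → v 0 k ℤ.+ s) (coefficient-∑≤ n (v ∘ suc) k)

⊛≈* : ∀ F G → (F ⊛ G) ≈ (F S.* G)
⊛≈* F G n k = begin
  (F ⊛ G) n k
    ≡⟨ sumℤ-applyUpTo n (λ i → i) (λ i → sumℤ (map (λ j → F i j ℤ.* G (n ∸ i) (k ∸ j)) (upTo (suc k)))) ⟩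
  ∑ℤ.∑≤ n (λ i → sumℤ (map (λ j → F i j ℤ.* G (n ∸ i) (k ∸ j)) (upTo (suc k))))
    ≡⟨ ∑ℤ.∑≤-cong′ n (λ i → sumℤ-applyUpTo k (λ j → j) (λ j → F i j ℤ.* G (n ∸ i) (k ∸ j))) ⟩
  ∑ℤ.∑≤ n (λ i → ∑ℤ.∑≤ k (λ j → F i j ℤ.* G (n ∸ i) (k ∸ j)))
    ≡⟨ coefficient-∑≤ n (λ i → F i ℤ[[y]].*ₛ G (n ∸ i)) k ⟨
  (F S.* G) n k ∎
  where open ≡.≡-Reasoning

gf : (ℕ → ℕ → ℕ) → PS
gf f n k = + f n k

+-∑≤ : ∀ n (h : ℕ → ℕ) → + ∑ℕ.∑≤ n h ≡ ∑ℤ.∑≤ n (λ i → + h i)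
+-∑≤ zero    h = ℤ.pos-+ (h 0) 0
+-∑≤ (suc n) h = trans (ℤ.pos-+ (h 0) _) (cong (λ s → + h 0 ℤ.+ s) (+-∑≤ n (h ∘ suc)))

gf-+ : ∀ f g → gf (f +ᶜ g) ≈ (gf f S.+ gf g)
gf-+ f g n k = ℤ.pos-+ (f n k) (g n k)

gf-✶ : ∀ f g → gf (f ✶ g) ≈ (gf f S.* gf g)
gf-✶ f g n k = begin
  + (f ✶ g) n k
    ≡⟨ +-∑≤ n (λ i → ∑ℕ.∑≤ k (λ j → f i j ℕ.* g (n ∸ i) (k ∸ j))) ⟩
  ∑ℤ.∑≤ n (λ i → + ∑ℕ.∑≤ k (λ j → f i j ℕ.* g (n ∸ i) (k ∸ j)))
    ≡⟨ ∑ℤ.∑≤-cong′ n (λ i → trans (+-∑≤ k (λ j → f i j ℕ.* g (n ∸ i) (k ∸ j)))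
                                   (∑ℤ.∑≤-cong′ k (λ j → ℤ.pos-* (f i j) (g (n ∸ i) (k ∸ j))))) ⟩
  ∑ℤ.∑≤ n (λ i → ∑ℤ.∑≤ k (λ j → gf f i j ℤ.* gf g (n ∸ i) (k ∸ j)))
    ≡⟨ coefficient-∑≤ n (λ i → gf f i ℤ[[y]].*ₛ gf g (n ∸ i)) k ⟨
  (gf f S.* gf g) n k ∎
  where open ≡.≡-Reasoning

gf-monomial₀₀ : gf (monomial 0 0) ≈ 𝟏
gf-monomial₀₀ zero    zero    = refl
gf-monomial₀₀ zero    (suc k) = refl
gf-monomial₀₀ (suc n) k       = refl

gf-monomial₁₀ : gf (monomial 1 0) ≈ xS
gf-monomial₁₀ zero          k       = refl
gf-monomial₁₀ (suc zero)    zero    = refl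
gf-monomial₁₀ (suc zero)    (suc k) = refl
gf-monomial₁₀ (suc (suc n)) k       = refl

gf-diagonal : gf #diagonal ≈ geomXY
gf-diagonal n k with n ℕ.≡ᵇ k
... | true  = refl
... | false = refl

oneS≈𝟏 : oneS ≈ 𝟏
oneS≈𝟏 zero    zero    = refl
oneS≈𝟏 zero    (suc k) = refl
oneS≈𝟏 (suc n) k       = refl

·≈* : ∀ c H → (c · H) ≈ (ℤ[[x,y]].constant (ℤ[[y]].constant c) S.* H)
·≈* c H n k = sym (trans (ℤ[[x,y]].constant-*ₛ (ℤ[[y]].constant c) H n k) (ℤ[[y]].constant-*ₛ c (H n) k))

≅-gf : ∀ {X Y f g} → Counts X f → X ≅ Y → Counts Y g → gf f ≈ gf g
≅-gf cX X≅Y cY n k = cong +_ (counts-unique cX (≅-counts X≅Y cY) n k)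

y : PS
y = gf (monomial 0 1)

gf-monomial₁₁ : gf (monomial 1 1) ≈ (xS S.* y)
gf-monomial₁₁ = S.trans (≅-gf (atom-counts 1 1) atom₁₁≅ (×ᶜ-counts (atom-counts 1 0) (atom-counts 0 1)))
                        (S.trans (gf-✶ (monomial 1 0) (monomial 0 1)) (S.*-congʳ {y} gf-monomial₁₀))

module LCOCounts (a : ℕ → ℕ → ℕ) (enumerate-forests : ∀ n k → Fin (a n k) ↔ LCO n k) where

  -- LCO n k is Elements forests n k by definition.
  forests-counts : Counts forests a
  forests-counts = counts enumerate-forests

  #trees : ℕ → ℕ → ℕ
  #trees = ∣-count forests-counts isSingleton

  trees-counts : Counts trees #trees
  trees-counts = ≅-counts trees≅singletons (∣-counts forests-counts isSingleton)

  #rightmostTrees #childLists #childTails #leafVertices #labels #colors #decorations : ℕ → ℕ → ℕ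
  #rightmostTrees = ∣-count trees-counts leafOK
  #childLists     = ∣-count forests-counts isChildList
  #childTails     = ∣-count forests-counts isChildTail
  #leafVertices   = ∣-count trees-counts isLeaf
  #labels n k     = #leafVertices n (suc k)
  #colors         = monomial 0 0 +ᶜ monomial 0 0
  #decorations    = monomial 1 0 +ᶜ #colors ✶ #positives ✶ #labels

  rightmostTrees-counts : Counts rightmostTrees #rightmostTrees
  rightmostTrees-counts = ∣-counts trees-counts leafOK

  childLists-counts : Counts childLists #childLists
  childLists-counts = ∣-counts forests-counts isChildList

  childTails-counts : Counts childTails #childTails
  childTails-counts = ∣-counts forests-counts isChildTail

  leafVertices-counts : Counts leafVertices #leafVertices
  leafVertices-counts = ≅-counts leafVertices≅leaves (∣-counts trees-counts isLeaf)

  labels-counts : Counts labels #labels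
  labels-counts = withLeaf-counts leafVertices-counts

  colors-counts : Counts colors #colors
  colors-counts = ≅-counts colors≅ (⊎ᶜ-counts (atom-counts 0 0) (atom-counts 0 0))

  decorations-counts : Counts decorations #decorations
  decorations-counts =
    ≅-counts decorations≅
      (⊎ᶜ-counts (atom-counts 1 0) (×ᶜ-counts colors-counts (×ᶜ-counts positives-counts labels-counts)))

  forests-eq : gf a ≈ (𝟏 S.+ gf #trees S.* gf a)
  forests-eq = S.trans
    (≅-gf forests-counts forests≅ (⊎ᶜ-counts (atom-counts 0 0) (×ᶜ-counts trees-counts forests-counts)))
    (S.trans (gf-+ (monomial 0 0) (#trees ✶ a)) (S.+-cong gf-monomial₀₀ (gf-✶ #trees a)))

  trees-eq : gf #trees ≈ (y S.* gf #labels S.+ gf #decorations S.* gf #childLists)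
  trees-eq = S.trans
    (≅-gf trees-counts trees≅ (⊎ᶜ-counts leafVertices-counts (×ᶜ-counts decorations-counts childLists-counts)))
    (S.trans (gf-+ #leafVertices (#decorations ✶ #childLists)) (S.+-cong leafVertices-eq (gf-✶ #decorations #childLists)))
    where
    leafVertices-eq : gf #leafVertices ≈ (y S.* gf #labels)
    leafVertices-eq = S.trans
      (≅-gf leafVertices-counts leafVertices≅ (×ᶜ-counts (atom-counts 0 1) labels-counts))
      (gf-✶ (monomial 0 1) #labels)

  children-eq : gf #childLists ≈ (gf #trees S.* gf #childTails)
  children-eq = S.trans
    (≅-gf childLists-counts childLists≅ (×ᶜ-counts trees-counts childTails-counts))
    (gf-✶ #trees #childTails)

  children₁-eq : gf #childTails ≈ (gf #rightmostTrees S.+ gf #trees S.* gf #childTails)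
  children₁-eq = S.trans
    (≅-gf childTails-counts childTails≅ (⊎ᶜ-counts rightmostTrees-counts (×ᶜ-counts trees-counts childTails-counts)))
    (S.trans (gf-+ #rightmostTrees (#trees ✶ #childTails)) (S.+-congˡ {gf #rightmostTrees} (gf-✶ #trees #childTails)))

  rightmost-eq : gf #trees ≈ (gf #rightmostTrees S.+ xS S.* y)
  rightmost-eq = S.trans
    (≅-gf trees-counts trees≅rightmost (⊎ᶜ-counts rightmostTrees-counts (atom-counts 1 1)))
    (S.trans (gf-+ #rightmostTrees (monomial 1 1)) (S.+-congˡ {gf #rightmostTrees} gf-monomial₁₁))

  labels-eq : gf #labels ≈ (xS S.+ gf #positives S.* gf #labels)
  labels-eq = S.trans
    (≅-gf labels-counts labels≅ (⊎ᶜ-counts (atom-counts 1 0) (×ᶜ-counts positives-counts labels-counts)))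
    (S.trans (gf-+ (monomial 1 0) (#positives ✶ #labels)) (S.+-cong gf-monomial₁₀ (gf-✶ #positives #labels)))

  positives-eq : gf #positives ≈ (xS S.+ xS S.* gf #positives)
  positives-eq = S.trans
    (≅-gf positives-counts positives≅ (⊎ᶜ-counts (atom-counts 1 0) (×ᶜ-counts (atom-counts 1 0) positives-counts)))
    (S.trans (gf-+ (monomial 1 0) (monomial 1 0 ✶ #positives))
             (S.+-cong gf-monomial₁₀ (S.trans (gf-✶ (monomial 1 0) #positives) (S.*-congʳ {gf #positives} gf-monomial₁₀))))

  decorations-eq : gf #decorations ≈ (xS S.+ gf #colors S.* (gf #positives S.* gf #labels))
  decorations-eq = S.trans (gf-+ (monomial 1 0) (#colors ✶ #positives ✶ #labels))
    (S.+-cong gf-monomial₁₀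
              (S.trans (gf-✶ #colors (#positives ✶ #labels)) (S.*-congˡ {gf #colors} (gf-✶ #positives #labels))))

  colors-eq : gf #colors ≈ (𝟏 S.+ 𝟏)
  colors-eq = S.trans (gf-+ (monomial 0 0) (monomial 0 0)) (S.+-cong gf-monomial₀₀ gf-monomial₀₀)

  diagonal-eq : gf #diagonal ≈ (𝟏 S.+ xS S.* y S.* gf #diagonal)
  diagonal-eq = S.trans
    (≅-gf diagonal-counts diagonal≅ (⊎ᶜ-counts (atom-counts 0 0) (×ᶜ-counts (atom-counts 1 1) diagonal-counts)))
    (S.trans (gf-+ (monomial 0 0) (monomial 1 1 ✶ #diagonal))
             (S.+-cong gf-monomial₀₀ (S.trans (gf-✶ (monomial 1 1) #diagonal) (S.*-congʳ {gf #diagonal} gf-monomial₁₁))))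

  forests-square-root :
    ((𝟏 S.- 𝟐 S.* (xS S.* gf a)) S.* (𝟏 S.- 𝟐 S.* (xS S.* gf a))) ≈ (𝟏 S.- 𝟒 S.* (xS S.* ((𝟏 S.- xS) S.* gf #diagonal)))
  forests-square-root = square-root xS y (gf a) (gf #trees) (gf #rightmostTrees) (gf #childLists) (gf #childTails)
    (gf #labels) (gf #positives) (gf #decorations) (gf #colors) (gf #diagonal)
    forests-eq trees-eq children-eq children₁-eq rightmost-eq labels-eq positives-eq decorations-eq colors-eq diagonal-eq

one-minus : ∀ H → (oneS ⊖ H) ≈ (𝟏 S.- H)
one-minus H = S.+-congʳ oneS≈𝟏

twice : ∀ H → ((+ 2) · (xS ⊛ H)) ≈ (𝟐 S.* (xS S.* H))
twice H = S.trans (·≈* (+ 2) (xS ⊛ H)) (S.*-congˡ {𝟐} (⊛≈* xS H))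

radicand≈ : radicand ≈ (𝟏 S.- 𝟒 S.* (xS S.* ((𝟏 S.- xS) S.* gf #diagonal)))
radicand≈ =
  S.trans (one-minus _) (S.+-congˡ {𝟏} (S.-‿cong (S.trans (·≈* (+ 4) (xS ⊛ ((oneS ⊖ xS) ⊛ geomXY))) (S.*-congˡ {𝟒} product≈))))
  where
  product≈ : (xS ⊛ ((oneS ⊖ xS) ⊛ geomXY)) ≈ (xS S.* ((𝟏 S.- xS) S.* gf #diagonal))
  product≈ = S.trans (⊛≈* xS ((oneS ⊖ xS) ⊛ geomXY))
    (S.*-congˡ {xS} (S.trans (⊛≈* (oneS ⊖ xS) geomXY) (S.*-cong (one-minus xS) (S.sym gf-diagonal))))

i≡j-[j-i] : ∀ o c → c ≡ o ℤ.- (o ℤ.- c)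
i≡j-[j-i] = solve-∀

proposition15 : (a : ℕ → ℕ → ℕ) → (∀ n k → Fin (a n k) ↔ LCO n k) →
    Σ PS (λ S → (S 0 0 ≡ + 1) × ((S ⊛ S) ≈ radicand) ×
    (((+ 2) · (xS ⊛ (λ n k → + (a n k)))) ≈ (oneS ⊖ S)))
proposition15 a enumerate-forests = S₀ , refl , S₀² , λ n k → i≡j-[j-i] (oneS n k) _
  where
  open LCOCounts a enumerate-forests using (forests-square-root)
  S₀ : PS
  S₀ = oneS ⊖ ((+ 2) · (xS ⊛ gf a))
  S₀≈ : S₀ ≈ (𝟏 S.- 𝟐 S.* (xS S.* gf a))
  S₀≈ = S.trans (one-minus _) (S.+-congˡ {𝟏} (S.-‿cong (twice (gf a))))
  S₀² : (S₀ ⊛ S₀) ≈ radicand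
  S₀² = S.trans (⊛≈* S₀ S₀) (S.trans (S.*-cong S₀≈ S₀≈) (S.trans forests-square-root (S.sym radicand≈)))
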